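{- The system $(\mathbf{EC})^\Delta$ (axiomatized by TAUT, $\Delta$Equ, $\Delta$C and the rules modus ponens and RE$\Delta$) is sound and strongly complete with respect to the class of all neighborhood frames satisfying both $(i)$ and $(c)$.
   Context: The language $\mathcal{L}(\Delta)$ is given by $\phi::=p\mid\neg\phi\mid\phi\land\phi\mid\Delta\phi$ with $p$ ranging over a fixed countably infinite set $\mathbf{P}$ of propositional variables. A neighborhood model is $\mathcal{M}=\langle S,N,V\rangle$ with $S\neq\emptyset$, $N:S\to\mathcal{P}(\mathcal{P}(S))$, $V:\mathbf{P}\to\mathcal{P}(S)$. Truth: $\mathcal{M},s\vDash p$ iff $s\in V(p)$; Boolean clauses as usual; $\mathcal{M},s\vDash\Delta\phi$ iff $\phi^{\mathcal{M}}\in N(s)$ or $S\setminus\phi^{\mathcal{M}}\in N(s)$, with $\phi^{\mathcal{M}}$ the truth set of $\phi$. A frame satisfies $(i)$ if for all $s$, $X,Y\in N(s)$ implies $X\cap Y\in N(s)$; it satisfies $(c)$ if for all $s$, $X\in N(s)$ implies $S\setminus X\in N(s)$. Axioms/rules: TAUT (all propositional tautologies), $\Delta$Equ: $\Delta\phi\leftrightarrow\Delta\neg\phi$; $\Delta$C: $\Delta\phi\land\Delta\psi\to\Delta(\phi\land\psi)$; RE$\Delta$: from $\phi\leftrightarrow\psi$ infer $\Delta\phi\leftrightarrow\Delta\psi$; plus modus ponens. Soundness: every theorem is valid on every frame of the class. Strong completeness: for every set $\Gamma$ and formula $\phi$, if $\phi$ holds at every state of every model on a frame in the class where all of $\Gamma$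 holds, then $\phi$ is derivable from $\Gamma$. -}

module Defs where

open import Data.Nat using (ℕ)
open import Data.Bool using (Bool; true; false; not; _∧_; _∨_)
open import Data.List using (List; []; _∷_)
open import Data.List.Relation.Unary.All using (All)
open import Data.Product using (Σ; _×_; _,_)
open import Relation.Binary.PropositionalEquality using (_≡_)

Var : Set
Var = ℕ

data Form : Set where
  var : Var → Form
  ¬'_ : Form → Form
  _∧'_ : Form → Form → Form
  Δ_ : Form → Form

infixr 6 _∧'_
infixr 5 _→'_
infix 4 _↔'_

_→'_ : Form → Form → Form
φ →' ψ = ¬' (φ ∧' ¬' ψ)

_↔'_ : Form → Form → Form
φ ↔' ψ = (φ →' ψ) ∧' (ψ →' φ)

⊤' : Form
⊤' = ¬' (var 0 ∧' ¬' var 0)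

⋀ : List Form → Form
⋀ [] = ⊤'
⋀ (φ ∷ φs) = φ ∧' ⋀ φs

evalB : (Form → Bool) → Form → Bool
evalB v (var p) = v (var p)
evalB v (¬' φ) = not (evalB v φ)
evalB v (φ ∧' ψ) = evalB v φ ∧ evalB v ψ
evalB v (Δ φ) = v (Δ φ)

-- φ is (an instance of) a propositional tautology.
Taut : Form → Set
Taut φ = (v : Form → Bool) → evalB v φ ≡ true

data ⊢_ : Form → Set where
  taut : ∀ {φ} → Taut φ → ⊢ φ
  ΔEqu : ∀ φ → ⊢ (Δ φ ↔' Δ (¬' φ))
  ΔC   : ∀ φ ψ → ⊢ ((Δ φ ∧' Δ ψ) →' Δ (φ ∧' ψ))
  mp   : ∀ {φ ψ} → ⊢ φ → ⊢ (φ →' ψ) → ⊢ ψ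
  REΔ  : ∀ {φ ψ} → ⊢ (φ ↔' ψ) → ⊢ (Δ φ ↔' Δ ψ)

infix 3 ⊢_ _⊢_ _⊨_

FormSet : Set₁
FormSet = Form → Set

_⊢_ : FormSet → Form → Set
Γ ⊢ φ = Σ (List Form) λ γs → All Γ γs × (⊢ (⋀ γs →' φ))

-- Classical rendering: subsets of S are characteristic functions S → Bool,
-- and the neighborhood collection N(s) ⊆ P(S) is likewise given by its
-- characteristic function (S → Bool) → Bool.  Since set-theoretic subsets are
-- extensional, N(s) must not distinguish pointwise-equal subsets.
record Frame : Set₁ where
  field
    S     : Set
    pt    : S                               -- S ≠ ∅
    N     : S → (S → Bool) → Bool
    N-ext : ∀ s (X Y : S → Bool) → (∀ x → X x ≡ Y x) → N s X ≡ N s Y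

open Frame public

_∩_ : {A : Set} → (A → Bool) → (A → Bool) → (A → Bool)
(X ∩ Y) x = X x ∧ Y x

∁ : {A : Set} → (A → Bool) → (A → Bool)
∁ X x = not (X x)

Cond-i : Frame → Set
Cond-i F = ∀ s X Y → N F s X ≡ true → N F s Y ≡ true → N F s (X ∩ Y) ≡ true

Cond-c : Frame → Set
Cond-c F = ∀ s X → N F s X ≡ true → N F s (∁ X) ≡ true

record Model : Set₁ where
  field
    frame : Frame
    V     : Var → S frame → Bool

open Model public

⟦_⟧ : (M : Model) → Form → S (frame M) → Bool
⟦ M ⟧ (var p) s = V M p s
⟦ M ⟧ (¬' φ) s = not (⟦ M ⟧ φ s)
⟦ M ⟧ (φ ∧' ψ) s = ⟦ M ⟧ φ s ∧ ⟦ M ⟧ ψ s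
⟦ M ⟧ (Δ φ) s = N (frame M) s (⟦ M ⟧ φ) ∨ N (frame M) s (∁ (⟦ M ⟧ φ))

Sat : (M : Model) → S (frame M) → Form → Set
Sat M s φ = ⟦ M ⟧ φ s ≡ true

InClass : Frame → Set
InClass F = Cond-i F × Cond-c F

ValidOn : Frame → Form → Set
ValidOn F φ = (Val : Var → S F → Bool) (s : S F) →
  Sat (record { frame = F ; V = Val }) s φ

Sound : Set₁
Sound = ∀ {φ} → ⊢ φ → (F : Frame) → InClass F → ValidOn F φ

_⊨_ : FormSet → Form → Set₁
Γ ⊨ φ = (F : Frame) → InClass F → (Val : Var → S F → Bool) (s : S F) →
  let M = record { frame = F ; V = Val } in
  (∀ γ → Γ γ → Sat M s γ) → Sat M s φ

StronglyComplete : Set₁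
StronglyComplete = ∀ (Γ : FormSet) φ → Γ ⊨ φ → Γ ⊢ φ

-- Soundness: with (c), a state satisfies Δφ exactly when the truth set of φ is a
-- neighbourhood, so ΔC is condition (i); ΔEqu and REΔ hold on every frame.
-- Completeness: the canonical frame has the maximal consistent sets as states and
-- declares X a neighbourhood of u when X is the truth set of some χ with Δχ ∈ u.
-- ΔEqu and ΔC make this frame satisfy (c) and (i), and REΔ, together with the
-- fact that formulas with the same truth set are provably equivalent, gives the
-- truth lemma for Δ.  Lindenbaum's lemma, along an enumeration of the formulas and
-- with excluded middle deciding each step, supplies the countermodels.
module Submission where

open import Defs
open import Axiom.ExcludedMiddle using (ExcludedMiddle)
open import Level using (0ℓ)
open import Data.Bool using (Bool; true; false; not; _∧_; _∨_)
open import Data.Bool.Properties using (not-involutive; ∧-assoc; ∨-comm)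
open import Data.Empty using (⊥; ⊥-elim)
open import Data.List using (List; []; _∷_; _++_; map; cartesianProductWith)
open import Data.List.Membership.Propositional using (_∈_)
open import Data.List.Membership.Propositional.Properties
  using (∈-++⁺ˡ; ∈-++⁺ʳ; ∈-map⁺; ∈-cartesianProductWith⁺)
open import Data.List.Relation.Unary.All as All using (All; []; _∷_)
open import Data.List.Relation.Unary.All.Properties using (++⁺)
open import Data.List.Relation.Unary.Any using (here; there)
open import Data.Nat using (ℕ; zero; suc; _⊔_; _≤′_; ≤′-refl; ≤′-step)
open import Data.Nat.Properties using (m≤m⊔n; m≤n⊔m; ≤⇒≤′)
open import Data.Product using (Σ-syntax; ∃; _×_; _,_; proj₁; proj₂)
open import Data.Sum as Sum using (_⊎_; inj₁; inj₂; [_,_]′)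
open import Function using (_∘_; id; case_of_)
open import Function.Bundles using (mk⇔)
open import Relation.Binary.PropositionalEquality
  using (_≡_; _≗_; refl; sym; trans; cong; cong₂)
open import Relation.Nullary using (Dec; yes; no; does; ¬_)
open import Relation.Nullary.Decidable
  using (dec-true; dec-false; does-⇔; ¬?; _×-dec_; decidable-stable)
open import Relation.Unary using (_⊆_; _∪_; ｛_｝; ∅)

infixr 6 _⇒ᵇ_
infix 5 _⇔ᵇ_
infix 4 _⇛_

_⇒ᵇ_ : Bool → Bool → Bool
a ⇒ᵇ b = not (a ∧ not b)

_⇔ᵇ_ : Bool → Bool → Bool
a ⇔ᵇ b = (a ⇒ᵇ b) ∧ (b ⇒ᵇ a)

⇒ᵇ-intro : ∀ {a b} → (a ≡ true → b ≡ true) → a ⇒ᵇ b ≡ true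
⇒ᵇ-intro {false} _ = refl
⇒ᵇ-intro {true} {true} _ = refl
⇒ᵇ-intro {true} {false} h = h refl

⇒ᵇ-elim : ∀ {a b} → a ⇒ᵇ b ≡ true → a ≡ true → b ≡ true
⇒ᵇ-elim {true} {true} _ _ = refl

⇔ᵇ-reflexive : ∀ {a b} → a ≡ b → a ⇔ᵇ b ≡ true
⇔ᵇ-reflexive {true} refl = refl
⇔ᵇ-reflexive {false} refl = refl

⇔ᵇ-≡ : ∀ {a b} → a ⇔ᵇ b ≡ true → a ≡ b
⇔ᵇ-≡ {true} {true} _ = refl
⇔ᵇ-≡ {false} {false} _ = refl

∧-intro : ∀ {a b} → a ≡ true → b ≡ true → a ∧ b ≡ true
∧-intro refl refl = refl

∧-elim : ∀ {a b} → a ∧ b ≡ true → a ≡ true × b ≡ true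
∧-elim {true} h = refl , h

∨-introˡ : ∀ {a b} → a ≡ true → a ∨ b ≡ true
∨-introˡ refl = refl

∨-elim : ∀ {a b} → a ∨ b ≡ true → a ≡ true ⊎ b ≡ true
∨-elim {true} _ = inj₁ refl
∨-elim {false} h = inj₂ h

true-or-not : ∀ a → a ≡ true ⊎ not a ≡ true
true-or-not true = inj₁ refl
true-or-not false = inj₂ refl

true-⇔-≡ : ∀ {a b} → (a ≡ true → b ≡ true) → (b ≡ true → a ≡ true) → a ≡ b
true-⇔-≡ {true} f _ = sym (f refl)
true-⇔-≡ {false} {true} _ g = g refl
true-⇔-≡ {false} {false} _ _ = refl

does-true : ∀ {A : Set} (a? : Dec A) → does a? ≡ true → A
does-true (yes a) _ = a

∁-involutive : ∀ {A : Set} (X : A → Bool) → ∁ (∁ X) ≗ X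
∁-involutive X x = not-involutive (X x)

model : (F : Frame) → (Var → S F → Bool) → Model
model F Val = record { frame = F ; V = Val }

Δᴺ : (F : Frame) → S F → (S F → Bool) → Bool
Δᴺ F s X = N F s X ∨ N F s (∁ X)

Δᴺ-ext : ∀ F s {X Y} → X ≗ Y → Δᴺ F s X ≡ Δᴺ F s Y
Δᴺ-ext F s {X} {Y} X≗Y =
  cong₂ _∨_ (N-ext F s X Y X≗Y) (N-ext F s (∁ X) (∁ Y) (cong not ∘ X≗Y))

Δᴺ-∁ : ∀ F s X → Δᴺ F s X ≡ Δᴺ F s (∁ X)
Δᴺ-∁ F s X =
  trans (∨-comm (N F s X) _) (cong (N F s (∁ X) ∨_) (N-ext F s X (∁ (∁ X)) (sym ∘ ∁-involutive X)))

Δᴺ⇒N : ∀ F → Cond-c F → ∀ s X → Δᴺ F s X ≡ true → N F s X ≡ true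
Δᴺ⇒N F c s X h with ∨-elim {N F s X} h
... | inj₁ X∈N = X∈N
... | inj₂ ∁X∈N = trans (N-ext F s X (∁ (∁ X)) (sym ∘ ∁-involutive X)) (c s (∁ X) ∁X∈N)

evalB-⟦⟧ : ∀ M s φ → evalB (λ ψ → ⟦ M ⟧ ψ s) φ ≡ ⟦ M ⟧ φ s
evalB-⟦⟧ M s (var p) = refl
evalB-⟦⟧ M s (¬' φ) = cong not (evalB-⟦⟧ M s φ)
evalB-⟦⟧ M s (φ ∧' ψ) = cong₂ _∧_ (evalB-⟦⟧ M s φ) (evalB-⟦⟧ M s ψ)
evalB-⟦⟧ M s (Δ φ) = refl

sound : Sound
sound (taut {φ} t) F _ Val s = trans (sym (evalB-⟦⟧ (model F Val) s φ)) (t _)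
sound (ΔEqu φ) F _ Val s = ⇔ᵇ-reflexive (Δᴺ-∁ F s (⟦ model F Val ⟧ φ))
sound (ΔC φ ψ) F (i , c) Val s = ⇒ᵇ-intro λ h →
  let ΔX , ΔY = ∧-elim {Δᴺ F s X} h
  in  ∨-introˡ (i s X Y (Δᴺ⇒N F c s X ΔX) (Δᴺ⇒N F c s Y ΔY))
  where
  X = ⟦ model F Val ⟧ φ
  Y = ⟦ model F Val ⟧ ψ
sound (mp p q) F ic Val s = ⇒ᵇ-elim (sound q F ic Val s) (sound p F ic Val s)
sound (REΔ p) F ic Val s = ⇔ᵇ-reflexive (Δᴺ-ext F s λ x → ⇔ᵇ-≡ (sound p F ic Val x))

_⇛_ : Form → Form → Set
φ ⇛ ψ = ∀ v → evalB v φ ≡ true → evalB v ψ ≡ true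

⊤'-true : ∀ v → evalB v ⊤' ≡ true
⊤'-true v with v (var 0)
... | true = refl
... | false = refl

⊥' : Form
⊥' = ¬' ⊤'

⊥'-elim : ∀ {A : Set} v → evalB v ⊥' ≡ true → A
⊥'-elim v h with trans (sym h) (cong not (⊤'-true v))
... | ()

explosion : ∀ φ → φ ∧' ¬' φ ⇛ ⊥'
explosion φ v h with evalB v φ | h
... | true | ()

⋀-++ : ∀ v φs ψs → evalB v (⋀ (φs ++ ψs)) ≡ evalB v (⋀ φs) ∧ evalB v (⋀ ψs)
⋀-++ v [] ψs rewrite ⊤'-true v = refl
⋀-++ v (φ ∷ φs) ψs rewrite ⋀-++ v φs ψs = sym (∧-assoc (evalB v φ) _ _)

taut-mp : ∀ {φ ψ} → ⊢ φ → φ ⇛ ψ → ⊢ ψ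
taut-mp p h = mp p (taut λ v → ⇒ᵇ-intro (h v))

⊢-∧ : ∀ {φ ψ} → ⊢ φ → ⊢ ψ → ⊢ (φ ∧' ψ)
⊢-∧ {φ} {ψ} p q =
  mp q (mp p (taut λ v → ⇒ᵇ-intro {evalB v φ} λ eφ → ⇒ᵇ-intro {evalB v ψ} (∧-intro eφ)))

⊢-↔⇒→ : ∀ {φ ψ} → ⊢ (φ ↔' ψ) → ⊢ (φ →' ψ)
⊢-↔⇒→ p = taut-mp p λ _ → proj₁ ∘ ∧-elim

⊢-premise : ∀ {Γ φ} → Γ φ → Γ ⊢ φ
⊢-premise {φ = φ} γ = φ ∷ [] , γ ∷ [] , taut λ v → ⇒ᵇ-intro (proj₁ ∘ ∧-elim {evalB v φ})

⊢-theorem : ∀ {Γ φ} → ⊢ φ → Γ ⊢ φ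
⊢-theorem p = [] , [] , taut-mp p λ _ eφ → ⇒ᵇ-intro λ _ → eφ

⊢-taut-mp : ∀ {Γ φ ψ} → Γ ⊢ φ → φ ⇛ ψ → Γ ⊢ ψ
⊢-taut-mp (γs , γs∈Γ , p) h = γs , γs∈Γ , taut-mp p λ v e → ⇒ᵇ-intro (h v ∘ ⇒ᵇ-elim e)

⊢-∧-intro : ∀ {Γ φ ψ} → Γ ⊢ φ → Γ ⊢ ψ → Γ ⊢ (φ ∧' ψ)
⊢-∧-intro {φ = φ} (γs , γs∈Γ , p) (δs , δs∈Γ , q) =
  γs ++ δs , ++⁺ γs∈Γ δs∈Γ , taut-mp (⊢-∧ p q) λ v h →
    ⇒ᵇ-intro {evalB v (⋀ (γs ++ δs))} λ e →
    let γs-true , δs-true = ∧-elim {evalB v (⋀ γs)} (trans (sym (⋀-++ v γs δs)) e)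
        γs⇒φ , δs⇒ψ = ∧-elim {evalB v (⋀ γs →' φ)} h
    in  ∧-intro (⇒ᵇ-elim {evalB v (⋀ γs)} γs⇒φ γs-true)
                (⇒ᵇ-elim {evalB v (⋀ δs)} δs⇒ψ δs-true)

⊢-from-∅ : ∀ {φ} → ∅ ⊢ φ → ⊢ φ
⊢-from-∅ ([] , [] , p) = mp (taut ⊤'-true) p

deduction : ∀ {Γ a b} → (Γ ∪ ｛ a ｝) ⊢ b → Γ ⊢ (a →' b)
deduction {Γ} {a} (γs , γs∈Γ+a , p) =
  ⊢-taut-mp (⊢-∧-intro (a→⋀ γs γs∈Γ+a) (⊢-theorem p)) λ v h → ⇒ᵇ-intro {evalB v a} λ ea →
    let a⇒γs , γs⇒b = ∧-elim {evalB v (a →' ⋀ γs)} h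
    in  ⇒ᵇ-elim γs⇒b (⇒ᵇ-elim a⇒γs ea)
  where
  a→⋀ : ∀ γs → All (Γ ∪ ｛ a ｝) γs → Γ ⊢ (a →' ⋀ γs)
  a→⋀ [] [] = ⊢-theorem (taut λ v → ⇒ᵇ-intro λ _ → ⊤'-true v)
  a→⋀ (γ ∷ γs) (inj₁ γ∈Γ ∷ rest) =
    ⊢-taut-mp (⊢-∧-intro (⊢-premise γ∈Γ) (a→⋀ γs rest)) λ v h → ⇒ᵇ-intro {evalB v a} λ ea →
      let γ-true , a⇒γs = ∧-elim {evalB v γ} h
      in  ∧-intro γ-true (⇒ᵇ-elim a⇒γs ea)
  a→⋀ (γ ∷ γs) (inj₂ refl ∷ rest) =
    ⊢-taut-mp (a→⋀ γs rest) λ v h → ⇒ᵇ-intro {evalB v a} λ ea → ∧-intro ea (⇒ᵇ-elim h ea)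

Consistent : FormSet → Set
Consistent Γ = ¬ (Γ ⊢ ⊥')

inconsistent-both : ∀ {Γ a} → (Γ ∪ ｛ a ｝) ⊢ ⊥' → (Γ ∪ ｛ ¬' a ｝) ⊢ ⊥' → Γ ⊢ ⊥'
inconsistent-both {a = a} p q =
  ⊢-taut-mp (⊢-∧-intro (deduction p) (deduction q)) λ v h →
    let a⇒⊥ , ¬a⇒⊥ = ∧-elim {evalB v (a →' ⊥')} h
    in  [ ⇒ᵇ-elim a⇒⊥ , ⇒ᵇ-elim ¬a⇒⊥ ]′ (true-or-not (evalB v a))

⊬⇒consistent-¬ : ∀ {Γ θ} → ¬ (Γ ⊢ θ) → Consistent (Γ ∪ ｛ ¬' θ ｝)
⊬⇒consistent-¬ {θ = θ} Γ⊬θ inc = Γ⊬θ (⊢-taut-mp (deduction inc) λ v h →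
  [ id , (λ e¬θ → ⊥'-elim v (⇒ᵇ-elim h e¬θ)) ]′ (true-or-not (evalB v θ)))

record Maximal (W : FormSet) : Set where
  field
    consistent : Consistent W
    decides    : ∀ a → W a ⊎ W (¬' a)

  exclusive : ∀ {a} → W a → W (¬' a) → ⊥
  exclusive {a} p q = consistent (⊢-taut-mp (⊢-∧-intro (⊢-premise p) (⊢-premise q)) (explosion a))

  closed : ∀ {a} → W ⊢ a → W a
  closed {a} p with decides a
  ... | inj₁ q = q
  ... | inj₂ q = ⊥-elim (consistent (⊢-taut-mp (⊢-∧-intro p (⊢-premise q)) (explosion a)))

record IsMCS (w : Form → Bool) : Set where
  field
    ⊢⇒true : ∀ {φ} → ⊢ φ → w φ ≡ true
    ¬-hom  : ∀ φ → w (¬' φ) ≡ not (w φ)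
    ∧-hom  : ∀ φ ψ → w (φ ∧' ψ) ≡ w φ ∧ w ψ

  evalB-hom : ∀ φ → evalB w φ ≡ w φ
  evalB-hom (var p) = refl
  evalB-hom (¬' φ) = trans (cong not (evalB-hom φ)) (sym (¬-hom φ))
  evalB-hom (φ ∧' ψ) = trans (cong₂ _∧_ (evalB-hom φ) (evalB-hom ψ)) (sym (∧-hom φ ψ))
  evalB-hom (Δ φ) = refl

  mp-closed : ∀ {φ ψ} → w φ ≡ true → ⊢ (φ →' ψ) → w ψ ≡ true
  mp-closed {φ} {ψ} wφ p =
    trans (sym (evalB-hom ψ))
      (⇒ᵇ-elim (trans (evalB-hom (φ →' ψ)) (⊢⇒true p)) (trans (evalB-hom φ) wφ))

  ↔-true : ∀ {φ ψ} → w φ ≡ w ψ → w (φ ↔' ψ) ≡ true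
  ↔-true {φ} {ψ} e =
    trans (sym (evalB-hom (φ ↔' ψ))) (⇔ᵇ-reflexive (trans (evalB-hom φ) (trans e (sym (evalB-hom ψ)))))

record World : Set where
  constructor world
  field
    val   : Form → Bool
    isMCS : IsMCS val

  open IsMCS isMCS public

open World

‖_‖ : Form → World → Bool
‖ φ ‖ u = val u φ

successors : List Form → List Form
successors φs = map ¬'_ φs ++ map Δ_ φs ++ cartesianProductWith _∧'_ φs φs

formulas : ℕ → List Form
formulas zero = []
formulas (suc n) = var n ∷ formulas n ++ successors (formulas n)

formulas-mono : ∀ {m n φ} → m ≤′ n → φ ∈ formulas m → φ ∈ formulas n
formulas-mono ≤′-refl p = p
formulas-mono (≤′-step m≤n) p = there (∈-++⁺ˡ (formulas-mono m≤n p))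

∈-successors : ∀ {n φ} → φ ∈ successors (formulas n) → φ ∈ formulas (suc n)
∈-successors {n} = there ∘ ∈-++⁺ʳ (formulas n)

∈-formulas : ∀ φ → ∃ λ n → φ ∈ formulas n
∈-formulas (var p) = suc p , here refl
∈-formulas (¬' φ) with ∈-formulas φ
... | n , p = suc n , ∈-successors (∈-++⁺ˡ (∈-map⁺ ¬'_ p))
∈-formulas (Δ φ) with ∈-formulas φ
... | n , p = suc n , ∈-successors (∈-++⁺ʳ (map ¬'_ (formulas n)) (∈-++⁺ˡ (∈-map⁺ Δ_ p)))
∈-formulas (φ ∧' ψ) with ∈-formulas φ | ∈-formulas ψ
... | m , p | n , q = suc (m ⊔ n) , ∈-successors (∈-++⁺ʳ (map ¬'_ fs) (∈-++⁺ʳ (map Δ_ fs)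
      (∈-cartesianProductWith⁺ _∧'_ (formulas-mono (≤⇒≤′ (m≤m⊔n m n)) p)
                                    (formulas-mono (≤⇒≤′ (m≤n⊔m m n)) q))))
  where fs = formulas (m ⊔ n)

module Completeness (em : ExcludedMiddle 0ℓ) where

  pick : ∀ {Γ a} → Dec (Consistent (Γ ∪ ｛ a ｝)) → Form
  pick {a = a} (yes _) = a
  pick {a = a} (no _) = ¬' a

  pick-consistent : ∀ {Γ a} (d : Dec (Consistent (Γ ∪ ｛ a ｝))) →
                    Consistent Γ → Consistent (Γ ∪ ｛ pick d ｝)
  pick-consistent (yes c) _ = c
  pick-consistent (no ¬c) cΓ inc = cΓ (inconsistent-both (decidable-stable em ¬c) inc)

  pick-decides : ∀ {Γ a} (d : Dec (Consistent (Γ ∪ ｛ a ｝))) → pick d ≡ a ⊎ pick d ≡ ¬' a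
  pick-decides (yes _) = inj₁ refl
  pick-decides (no _) = inj₂ refl

  extend : FormSet → Form → FormSet
  extend Γ a = Γ ∪ ｛ pick (em {Consistent (Γ ∪ ｛ a ｝)}) ｝

  extendAll : FormSet → List Form → FormSet
  extendAll Γ [] = Γ
  extendAll Γ (a ∷ as) = extendAll (extend Γ a) as

  extendAll-⊇ : ∀ {Γ} as → Γ ⊆ extendAll Γ as
  extendAll-⊇ [] γ = γ
  extendAll-⊇ (a ∷ as) γ = extendAll-⊇ as (inj₁ γ)

  extendAll-consistent : ∀ {Γ} as → Consistent Γ → Consistent (extendAll Γ as)
  extendAll-consistent [] c = c
  extendAll-consistent (a ∷ as) c = extendAll-consistent as (pick-consistent em c)

  extendAll-decides : ∀ {Γ a as} → a ∈ as → extendAll Γ as a ⊎ extendAll Γ as (¬' a)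
  extendAll-decides {as = a ∷ as} (here refl) =
    Sum.map (extendAll-⊇ as ∘ inj₂) (extendAll-⊇ as ∘ inj₂) (pick-decides em)
  extendAll-decides (there p) = extendAll-decides p

  module Lindenbaum (Γ₀ : FormSet) (Γ₀-consistent : Consistent Γ₀) where

    stage : ℕ → FormSet
    stage zero = Γ₀
    stage (suc n) = extendAll (stage n) (formulas n)

    limit : FormSet
    limit φ = ∃ λ n → stage n φ

    stage-mono : ∀ {m n} → m ≤′ n → stage m ⊆ stage n
    stage-mono ≤′-refl γ = γ
    stage-mono {n = suc n} (≤′-step m≤n) γ = extendAll-⊇ (formulas n) (stage-mono m≤n γ)

    stage-consistent : ∀ n → Consistent (stage n)
    stage-consistent zero = Γ₀-consistent
    stage-consistent (suc n) = extendAll-consistent (formulas n) (stage-consistent n)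

    finite-in-stage : ∀ {γs} → All limit γs → ∃ λ n → All (stage n) γs
    finite-in-stage [] = 0 , []
    finite-in-stage ((m , γ) ∷ rest) with finite-in-stage rest
    ... | n , rest′ =
      m ⊔ n , stage-mono (≤⇒≤′ (m≤m⊔n m n)) γ
            ∷ All.map (stage-mono (≤⇒≤′ (m≤n⊔m m n))) rest′

    limit-maximal : Maximal limit
    limit-maximal = record { consistent = consistent ; decides = decides }
      where
      consistent : Consistent limit
      consistent (γs , γs∈limit , p) with finite-in-stage γs∈limit
      ... | n , γs∈stage = stage-consistent n (γs , γs∈stage , p)
      decides : ∀ a → limit a ⊎ limit (¬' a)
      decides a with ∈-formulas a
      ... | n , a∈ = Sum.map (suc n ,_) (suc n ,_) (extendAll-decides a∈)

  maximal⇒mcs : ∀ {W} → Maximal W → IsMCS (λ a → does (em {W a}))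
  maximal⇒mcs {W} max = record
    { ⊢⇒true = λ p → dec-true em (closed (⊢-theorem p))
    ; ¬-hom  = λ φ → does-⇔ (mk⇔ (λ W¬φ Wφ → exclusive Wφ W¬φ) (W¬-from-¬W φ)) em (¬? em)
    ; ∧-hom  = λ φ ψ → does-⇔ (mk⇔ (∧-split φ ψ) ∧-join) em (em ×-dec em)
    }
    where
    open Maximal max
    W¬-from-¬W : ∀ φ → ¬ W φ → W (¬' φ)
    W¬-from-¬W φ ¬Wφ = [ ⊥-elim ∘ ¬Wφ , id ]′ (decides φ)
    ∧-join : ∀ {φ ψ} → W φ × W ψ → W (φ ∧' ψ)
    ∧-join (p , q) = closed (⊢-∧-intro (⊢-premise p) (⊢-premise q))
    ∧-split : ∀ φ ψ → W (φ ∧' ψ) → W φ × W ψ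
    ∧-split φ ψ w = closed (⊢-taut-mp (⊢-premise w) λ _ → proj₁ ∘ ∧-elim)
                  , closed (⊢-taut-mp (⊢-premise w) λ v → proj₂ ∘ ∧-elim {evalB v φ})

  lindenbaum : ∀ {Γ θ} → ¬ (Γ ⊢ θ) →
               Σ[ u ∈ World ] (Γ ⊆ (λ γ → val u γ ≡ true)) × val u θ ≡ false
  lindenbaum {Γ} {θ} Γ⊬θ =
    world _ (maximal⇒mcs limit-maximal) ,
    (λ γ → dec-true em (0 , inj₁ γ)) ,
    dec-false em (λ θ∈limit → exclusive θ∈limit (0 , inj₂ refl))
    where
    open Lindenbaum (Γ ∪ ｛ ¬' θ ｝) (⊬⇒consistent-¬ Γ⊬θ)
    open Maximal limit-maximal

  true-everywhere⇒⊢ : ∀ {θ} → (∀ u → val u θ ≡ true) → ⊢ θ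
  true-everywhere⇒⊢ true-everywhere = decidable-stable em λ ⊬θ →
    let (u , _ , u⊭θ) = lindenbaum (⊬θ ∘ ⊢-from-∅)
    in  case trans (sym u⊭θ) (true-everywhere u) of λ ()

  Δ-respects-truthSet : ∀ u {χ ψ} → ‖ χ ‖ ≗ ‖ ψ ‖ → val u (Δ χ) ≡ true → val u (Δ ψ) ≡ true
  Δ-respects-truthSet u χ≗ψ Δχ =
    mp-closed u Δχ (⊢-↔⇒→ (REΔ (true-everywhere⇒⊢ λ v → ↔-true v (χ≗ψ v))))

  CanonicalNeighbourhood : World → (World → Bool) → Set
  CanonicalNeighbourhood u X = Σ[ χ ∈ Form ] val u (Δ χ) ≡ true × X ≗ ‖ χ ‖

  canonicalN : World → (World → Bool) → Bool
  canonicalN u X = does (em {CanonicalNeighbourhood u X})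

  canonicalN-ext : ∀ u X Y → X ≗ Y → canonicalN u X ≡ canonicalN u Y
  canonicalN-ext u X Y X≗Y = does-⇔ (mk⇔
    (λ (χ , Δχ , X≗χ) → χ , Δχ , λ v → trans (sym (X≗Y v)) (X≗χ v))
    (λ (χ , Δχ , Y≗χ) → χ , Δχ , λ v → trans (X≗Y v) (Y≗χ v))) em em

  canonicalFrame : World → Frame
  canonicalFrame u₀ = record { S = World ; pt = u₀ ; N = canonicalN ; N-ext = canonicalN-ext }

  canonical-i : ∀ u₀ → Cond-i (canonicalFrame u₀)
  canonical-i _ u X Y X∈N Y∈N with does-true em X∈N | does-true em Y∈N
  ... | χ , Δχ , X≗χ | θ , Δθ , Y≗θ = dec-true em
    ( χ ∧' θ
    , mp-closed u (trans (∧-hom u (Δ χ) (Δ θ)) (∧-intro Δχ Δθ)) (ΔC χ θ)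
    , λ v → trans (cong₂ _∧_ (X≗χ v) (Y≗θ v)) (sym (∧-hom v χ θ)))

  canonical-c : ∀ u₀ → Cond-c (canonicalFrame u₀)
  canonical-c _ u X X∈N with does-true em X∈N
  ... | χ , Δχ , X≗χ = dec-true em
    ( ¬' χ
    , mp-closed u Δχ (⊢-↔⇒→ (ΔEqu χ))
    , λ v → trans (cong not (X≗χ v)) (sym (¬-hom v χ)))

  canonical-Δᴺ : ∀ u₀ u φ → Δᴺ (canonicalFrame u₀) u ‖ φ ‖ ≡ val u (Δ φ)
  canonical-Δᴺ u₀ u φ = true-⇔-≡
    (λ h → let φ∈N = Δᴺ⇒N (canonicalFrame u₀) (canonical-c u₀) u ‖ φ ‖ h
               (χ , Δχ , φ≗χ) = does-true em φ∈N
           in  Δ-respects-truthSet u (sym ∘ φ≗χ) Δχ)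
    (λ Δφ → ∨-introˡ (dec-true em (φ , Δφ , λ _ → refl)))

  canonicalValuation : Var → World → Bool
  canonicalValuation p u = val u (var p)

  canonicalModel : World → Model
  canonicalModel u₀ = model (canonicalFrame u₀) canonicalValuation

  truth-lemma : ∀ u₀ φ → ⟦ canonicalModel u₀ ⟧ φ ≗ ‖ φ ‖
  truth-lemma u₀ (var p) u = refl
  truth-lemma u₀ (¬' φ) u = trans (cong not (truth-lemma u₀ φ u)) (sym (¬-hom u φ))
  truth-lemma u₀ (φ ∧' ψ) u =
    trans (cong₂ _∧_ (truth-lemma u₀ φ u) (truth-lemma u₀ ψ u)) (sym (∧-hom u φ ψ))
  truth-lemma u₀ (Δ φ) u =
    trans (Δᴺ-ext (canonicalFrame u₀) u (truth-lemma u₀ φ)) (canonical-Δᴺ u₀ u φ)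

  complete : StronglyComplete
  complete Γ φ Γ⊨φ = decidable-stable em λ Γ⊬φ →
    let (u , Γ⊆u , u⊭φ) = lindenbaum Γ⊬φ
        u⊨φ = Γ⊨φ (canonicalFrame u) (canonical-i u , canonical-c u) canonicalValuation u
                  λ γ Γγ → trans (truth-lemma u γ u) (Γ⊆u Γγ)
    in  case trans (sym u⊭φ) (trans (sym (truth-lemma u φ u)) u⊨φ) of λ ()

mainTheorem3 : Sound × (ExcludedMiddle 0ℓ → StronglyComplete)
mainTheorem3 = sound , Completeness.complete
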